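{- Let $E$ be an elliptic curve over $\mathbb{Q}$ in short Weierstrass form $y^2=x^3+Ax+B$ with $A,B\in\mathbb{Z}$, such that the real locus $E(\mathbb{R})$ has two connected components, and let $E^B(\mathbb{R})$ be its bounded component. Then for every rational point $Q\in E(\mathbb{Q})\cap E^B(\mathbb{R})$, $$\log|x(Q)|\le 4h(E).$$
   Context: $\Delta=\Delta_E=-16(4A^3+27B^2)$ is the discriminant and $j=j_E$ the $j$-invariant of $E$. For a rational number $a/b$ in lowest terms, $h(a/b)=\log\max\{|a|,|b|\}$. The height of $E$ is $h(E)=\frac{1}{12}\max\{h(j),h(\Delta)\}$. -}

module Defs where

open import Data.Nat using (ℕ; suc; _⊔_)
open import Data.Integer using (ℤ; +_; +[1+_]; -[1+_]; -_; _+_; _*_; ∣_∣)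
open import Data.Rational as ℚ using (ℚ; _/_; 0ℚ; ↥_; ↧ₙ_)

-- The integer rational number p / q with q ≠ 0, normalised to lowest terms.
-- (For q = 0 it returns 0; this case never arises below since Δ ≠ 0.)
_÷ℤ_ : ℤ → ℤ → ℚ
p ÷ℤ (+ 0)     = 0ℚ
p ÷ℤ +[1+ n ]  = p / suc n
p ÷ℤ -[1+ n ]  = (- p) / suc n

cubeℤ : ℤ → ℤ
cubeℤ a = a * a * a

disc : ℤ → ℤ → ℤ
disc A B = - (+ 16) * (+ 4 * cubeℤ A + + 27 * (B * B))

jInv : ℤ → ℤ → ℚ
jInv A B = (- (+ 1728) * cubeℤ (+ 4 * A)) ÷ℤ disc A B

-- Multiplicative (exponential) height H(a/b) = max{|a|,|b|}, a/b in lowest terms,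
-- so that h(r) = log H(r).
Hℚ : ℚ → ℕ
Hℚ r = ∣ ↥ r ∣ ⊔ ↧ₙ r

Hℤ : ℤ → ℕ
Hℤ d = Hℚ (d / 1)

-- exp(12 h(E)) = max{H(j), H(Δ)}
HE : ℤ → ℤ → ℕ
HE A B = Hℚ (jInv A B) ⊔ Hℤ (disc A B)

weier : ℤ → ℤ → ℚ → ℚ
weier A B x = x ℚ.* x ℚ.* x ℚ.+ (A / 1) ℚ.* x ℚ.+ (B / 1)

OnCurve : ℤ → ℤ → ℚ → ℚ → Set
OnCurve A B x y = y ℚ.* y ≡ weier A B x
  where open import Relation.Binary.PropositionalEquality using (_≡_)

-- E(ℝ) has two connected components  ⇔  Δ > 0
TwoComponents : ℤ → ℤ → Set
TwoComponents A B = Data.Integer._>_ (disc A B) (+ 0)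
  where import Data.Integer

-- A real point (x,y) of E(ℝ) (when Δ > 0, with roots e₁ < e₂ < e₃ of f) lies on the
-- bounded component iff x ∈ [e₁, e₂], iff some point t > x has f(t) < 0
-- (the gap (e₂, e₃) separating the two components); t may be taken rational.
OnBoundedComponent : ℤ → ℤ → ℚ → Set
OnBoundedComponent A B x = Σ ℚ (λ t → (x ℚ.< t) × (weier A B t ℚ.< 0ℚ))
  where open import Data.Product using (Σ; _×_)

{-# OPTIONS --safe #-}
module Submission where

-- Write f(t) = t³ + At + B.  On the bounded component some t > x has f(t) < 0 although
-- f(x) = y² ≥ 0; since 4f(t) = 4f(x) + (t − x)((2t + x)² + 3x² + 4A), this forces
-- 3x² + 4A < 0.  So A < 0 and (3x²)³ < 64|A|³.  On the other hand jΔ = −1728(4A)³, hence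
-- 64|A|³ ≤ |jΔ| ≤ H(j) H(Δ) ≤ H(E)² with H(E) = max{H(j), H(Δ)} = exp(12 h(E)).
-- Thus |x|⁶ < H(E)², i.e. log|x| < 4 h(E).

open import Defs
open import Data.Integer using (ℤ)
open import Data.Rational using (ℚ; ∣_∣; _*_; _≤_; _/_)
open import Data.Integer using (+_)

open import Data.Empty using (⊥-elim)
open import Data.Nat as ℕ using (ℕ; suc)
import Data.Nat.Properties as ℕₚ
import Data.Nat.Coprimality as Coprimality
import Data.Integer as ℤ
open import Data.Integer using (-[1+_]; +[1+_])
open import Data.Integer.GCD using (gcd)
import Data.Integer.Properties as ℤₚ
import Data.Integer.Solver as ℤSolver
open import Data.Product using (_,_)
open import Data.Sum using (inj₁; inj₂)
open import Data.Rational using (_+_; _-_; -_; _<_; 0ℚ; ↥_; ↧_; ↧ₙ_; *≤*; Positive; nonNegative; nonPositive; positive)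
open import Data.Rational.Literals using (fromℤ)
open import Data.Rational.Properties
import Data.Rational.Solver as ℚSolver
open import Relation.Binary.PropositionalEquality
open import Relation.Nullary using (yes; no)

fromℕ : ℕ → ℚ
fromℕ n = fromℤ (+ n)

/1≡fromℤ : ∀ a → a / 1 ≡ fromℤ a
/1≡fromℤ (+ n)    = normalize-coprime (Coprimality.sym (Coprimality.1-coprimeTo n))
/1≡fromℤ -[1+ n ] = cong -_ (normalize-coprime (Coprimality.sym (Coprimality.1-coprimeTo (suc n))))

fromℤ-* : ∀ a b → fromℤ (a ℤ.* b) ≡ fromℤ a * fromℤ b
fromℤ-* a b = sym (/1≡fromℤ (a ℤ.* b))

fromℤ-mono-≤ : ∀ {a b} → a ℤ.≤ b → fromℤ a ≤ fromℤ b
fromℤ-mono-≤ {a} {b} a≤b = *≤* (subst₂ ℤ._≤_ (sym (ℤₚ.*-identityʳ a)) (sym (ℤₚ.*-identityʳ b)) a≤b)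

fromℕ-* : ∀ m n → fromℕ (m ℕ.* n) ≡ fromℕ m * fromℕ n
fromℕ-* m n = trans (cong fromℤ (ℤₚ.pos-* m n)) (fromℤ-* (+ m) (+ n))

fromℕ-mono-≤ : ∀ {m n} → m ℕ.≤ n → fromℕ m ≤ fromℕ n
fromℕ-mono-≤ m≤n = fromℤ-mono-≤ (ℤ.+≤+ m≤n)

0≤fromℕ : ∀ n → 0ℚ ≤ fromℕ n
0≤fromℕ n = fromℕ-mono-≤ ℕ.z≤n

0≤p*p : ∀ p → 0ℚ ≤ p * p
0≤p*p p with ≤-total 0ℚ p
... | inj₁ 0≤p = nonNegative⁻¹ _ {{nonNeg*nonNeg⇒nonNeg p {{nonNegative 0≤p}} p {{nonNegative 0≤p}}}}
... | inj₂ p≤0 = nonNegative⁻¹ _ {{nonPos*nonPos⇒nonPos p {{nonPositive p≤0}} p {{nonPositive p≤0}}}}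

0≤p*q : ∀ {p q} → 0ℚ ≤ p → 0ℚ ≤ q → 0ℚ ≤ p * q
0≤p*q {p} {q} 0≤p 0≤q = nonNegative⁻¹ _ {{nonNeg*nonNeg⇒nonNeg p {{nonNegative 0≤p}} q {{nonNegative 0≤q}}}}

0≤p+q : ∀ {p q} → 0ℚ ≤ p → 0ℚ ≤ q → 0ℚ ≤ p + q
0≤p+q {p} {q} 0≤p 0≤q = subst (_≤ p + q) (+-identityʳ 0ℚ) (+-mono-≤ 0≤p 0≤q)

p+q<0⇒p<-q : ∀ {p q} → p + q < 0ℚ → p < - q
p+q<0⇒p<-q {p} {q} p+q<0 = subst₂ _<_ p+q-q≡p (+-identityˡ (- q)) (+-monoˡ-< (- q) p+q<0)
  where
  open ℚSolver.+-*-Solver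
  p+q-q≡p : p + q - q ≡ p
  p+q-q≡p = solve 2 (λ p q → p :+ q :- q := p) refl p q

square-mono-≤ : ∀ {p q} → 0ℚ ≤ p → p ≤ q → p * p ≤ q * q
square-mono-≤ {p} {q} 0≤p p≤q =
  ≤-trans (*-monoˡ-≤-nonNeg p {{nonNegative 0≤p}} p≤q)
          (*-monoʳ-≤-nonNeg q {{nonNegative (≤-trans 0≤p p≤q)}} p≤q)

square-cancel-< : ∀ {p q} → 0ℚ ≤ q → p * p < q * q → p < q
square-cancel-< {p} {q} 0≤q p²<q² with p <? q
... | yes p<q = p<q
... | no p≮q = ⊥-elim (<-irrefl refl (<-≤-trans p²<q² (square-mono-≤ 0≤q (≮⇒≥ p≮q))))

cube-mono-< : ∀ {p q} → 0ℚ ≤ p → p < q → p * p * p < q * q * q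
cube-mono-< {p} {q} 0≤p p<q = begin-strict
  p * p * p  ≤⟨ *-monoʳ-≤-nonNeg p {{nonNegative 0≤p}} (square-mono-≤ 0≤p (<⇒≤ p<q)) ⟩
  q * q * p  <⟨ *-monoʳ-<-pos (q * q) {{pos*pos⇒pos q {{q⁺}} q {{q⁺}}}} p<q ⟩
  q * q * q  ∎
  where
  open ≤-Reasoning
  q⁺ : Positive q
  q⁺ = positive (≤-<-trans 0≤p p<q)

cubic : ℚ → ℚ → ℚ → ℚ
cubic a b x = x * x * x + a * x + b

4*cubic-expansion : ∀ a b x t →
  fromℕ 4 * cubic a b t ≡ fromℕ 4 * cubic a b x + (t - x) * ((fromℕ 2 * t + x) * (fromℕ 2 * t + x) + (fromℕ 3 * (x * x) + fromℕ 4 * a))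
4*cubic-expansion = solve 4 (λ a b x t →
  con (fromℕ 4) :* (t :* t :* t :+ a :* t :+ b) :=
  con (fromℕ 4) :* (x :* x :* x :+ a :* x :+ b) :+ (t :- x) :* ((con (fromℕ 2) :* t :+ x) :* (con (fromℕ 2) :* t :+ x) :+ (con (fromℕ 3) :* (x :* x) :+ con (fromℕ 4) :* a)))
  refl
  where open ℚSolver.+-*-Solver

bounded-component⇒3x²+4a<0 : ∀ a b {x t} → 0ℚ ≤ cubic a b x → x < t → cubic a b t < 0ℚ →
                             fromℕ 3 * (x * x) + fromℕ 4 * a < 0ℚ
bounded-component⇒3x²+4a<0 a b {x} {t} 0≤f[x] x<t f[t]<0
  with fromℕ 3 * (x * x) + fromℕ 4 * a <? 0ℚ
... | yes 3x²+4a<0 = 3x²+4a<0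
... | no 3x²+4a≮0 = ⊥-elim (<-irrefl refl (≤-<-trans 0≤4f[t] 4f[t]<0))
  where
  0<t-x : 0ℚ < t - x
  0<t-x = subst (_< t - x) (+-inverseʳ x) (+-monoˡ-< (- x) x<t)
  0≤4f[t] : 0ℚ ≤ fromℕ 4 * cubic a b t
  0≤4f[t] = subst (0ℚ ≤_) (sym (4*cubic-expansion a b x t))
    (0≤p+q (0≤p*q (0≤fromℕ 4) 0≤f[x])
           (0≤p*q (<⇒≤ 0<t-x) (0≤p+q (0≤p*p (fromℕ 2 * t + x)) (≮⇒≥ 3x²+4a≮0))))
  4f[t]<0 : fromℕ 4 * cubic a b t < 0ℚ
  4f[t]<0 = subst (fromℕ 4 * cubic a b t <_) (*-zeroʳ (fromℕ 4)) (*-monoʳ-<-pos (fromℕ 4) f[t]<0)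

Hℤ≡∣d∣⊔1 : ∀ d → Hℤ d ≡ ℤ.∣ d ∣ ℕ.⊔ 1
Hℤ≡∣d∣⊔1 d = cong Hℚ (/1≡fromℤ d)

↥[p/n]*n≡p*↧[p/n] : ∀ p n .{{_ : ℕ.NonZero n}} → ↥ (p / n) ℤ.* + n ≡ p ℤ.* ↧ (p / n)
↥[p/n]*n≡p*↧[p/n] p n = begin
  ↥ r ℤ.* + n              ≡⟨ cong (↥ r ℤ.*_) (sym (↧-/ p n)) ⟩
  ↥ r ℤ.* (↧ r ℤ.* g)      ≡⟨ solve 3 (λ u v w → u :* (v :* w) := u :* w :* v) refl (↥ r) (↧ r) g ⟩
  ↥ r ℤ.* g ℤ.* ↧ r        ≡⟨ cong (ℤ._* ↧ r) (↥-/ p n) ⟩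
  p ℤ.* ↧ r                ∎
  where
  open ≡-Reasoning
  open ℤSolver.+-*-Solver
  r : ℚ
  r = p / n
  g : ℤ
  g = gcd p (+ n)

∣p∣≤H[p÷q]*H[q] : ∀ p q → q ℤ.> + 0 → ℤ.∣ p ∣ ℕ.≤ Hℚ (p ÷ℤ q) ℕ.* Hℤ q
∣p∣≤H[p÷q]*H[q] p (+ 0) (ℤ.+<+ ())
∣p∣≤H[p÷q]*H[q] p +[1+ n ] _ = begin
  ℤ.∣ p ∣                     ≤⟨ ℕₚ.m≤m*n ℤ.∣ p ∣ (↧ₙ r) ⟩
  ℤ.∣ p ∣ ℕ.* ↧ₙ r            ≡⟨ cross-multiplied ⟩
  ℤ.∣ ↥ r ∣ ℕ.* suc n         ≤⟨ ℕₚ.*-mono-≤ (ℕₚ.m≤m⊔n ℤ.∣ ↥ r ∣ (↧ₙ r)) (ℕₚ.m≤m⊔n (suc n) 1) ⟩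
  Hℚ r ℕ.* (suc n ℕ.⊔ 1)      ≡⟨ cong (Hℚ r ℕ.*_) (sym (Hℤ≡∣d∣⊔1 +[1+ n ])) ⟩
  Hℚ r ℕ.* Hℤ +[1+ n ]        ∎
  where
  open ℕₚ.≤-Reasoning
  r : ℚ
  r = p / suc n
  cross-multiplied : ℤ.∣ p ∣ ℕ.* ↧ₙ r ≡ ℤ.∣ ↥ r ∣ ℕ.* suc n
  cross-multiplied = begin-equality
    ℤ.∣ p ∣ ℕ.* ↧ₙ r           ≡⟨ ℤₚ.abs-* p (↧ r) ⟨
    ℤ.∣ p ℤ.* ↧ r ∣            ≡⟨ cong ℤ.∣_∣ (↥[p/n]*n≡p*↧[p/n] p (suc n)) ⟨
    ℤ.∣ ↥ r ℤ.* + suc n ∣      ≡⟨ ℤₚ.abs-* (↥ r) (+ suc n) ⟩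
    ℤ.∣ ↥ r ∣ ℕ.* suc n        ∎

∣jNumerator∣ : ∀ m → ℤ.∣ ℤ.- (+ 1728) ℤ.* cubeℤ (+ 4 ℤ.* -[1+ m ]) ∣ ≡ 110592 ℕ.* (suc m ℕ.* suc m ℕ.* suc m)
∣jNumerator∣ m = cong ℤ.∣_∣ (solve 1 (λ a →
  :- con (+ 1728) :* ((con (+ 4) :* (:- a)) :* (con (+ 4) :* (:- a)) :* (con (+ 4) :* (:- a))) :=
  con (+ 110592) :* (a :* a :* a)) refl (+ suc m))
  where open ℤSolver.+-*-Solver

64∣A∣³≤27HE² : ∀ m B → TwoComponents -[1+ m ] B →
               64 ℕ.* (suc m ℕ.* suc m ℕ.* suc m) ℕ.≤ 27 ℕ.* (HE -[1+ m ] B ℕ.* HE -[1+ m ] B)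
64∣A∣³≤27HE² m B Δ>0 = begin
  64 ℕ.* a³                          ≤⟨ ℕₚ.*-monoˡ-≤ a³ (ℕₚ.m≤m+n 64 110528) ⟩
  110592 ℕ.* a³                      ≡⟨ ∣jNumerator∣ m ⟨
  ℤ.∣ jNumerator ∣                   ≤⟨ ∣p∣≤H[p÷q]*H[q] jNumerator (disc A B) Δ>0 ⟩
  Hj ℕ.* HΔ                          ≤⟨ ℕₚ.*-mono-≤ (ℕₚ.m≤m⊔n Hj HΔ) (ℕₚ.m≤n⊔m Hj HΔ) ⟩
  HE A B ℕ.* HE A B                  ≤⟨ ℕₚ.m≤n*m (HE A B ℕ.* HE A B) 27 ⟩
  27 ℕ.* (HE A B ℕ.* HE A B)         ∎
  where
  open ℕₚ.≤-Reasoning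
  A : ℤ
  A = -[1+ m ]
  a³ Hj HΔ : ℕ
  a³ = suc m ℕ.* suc m ℕ.* suc m
  Hj = Hℚ (jInv A B)
  HΔ = Hℤ (disc A B)
  jNumerator : ℤ
  jNumerator = ℤ.- (+ 1728) ℤ.* cubeℤ (+ 4 ℤ.* A)

64n³≡[4n]³ : ∀ n → fromℕ (64 ℕ.* (n ℕ.* n ℕ.* n)) ≡ fromℕ 4 * fromℕ n * (fromℕ 4 * fromℕ n) * (fromℕ 4 * fromℕ n)
64n³≡[4n]³ n = begin
  fromℕ (64 ℕ.* (n ℕ.* n ℕ.* n))            ≡⟨ fromℕ-* 64 (n ℕ.* n ℕ.* n) ⟩
  fromℕ 64 * fromℕ (n ℕ.* n ℕ.* n)          ≡⟨ cong (fromℕ 64 *_) (trans (fromℕ-* (n ℕ.* n) n) (cong (_* fromℕ n) (fromℕ-* n n))) ⟩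
  fromℕ 64 * (fromℕ n * fromℕ n * fromℕ n)  ≡⟨ solve 1 (λ m → con (fromℕ 64) :* (m :* m :* m) :=
                                                  con (fromℕ 4) :* m :* (con (fromℕ 4) :* m) :* (con (fromℕ 4) :* m)) refl (fromℕ n) ⟩
  fromℕ 4 * fromℕ n * (fromℕ 4 * fromℕ n) * (fromℕ 4 * fromℕ n) ∎
  where
  open ≡-Reasoning
  open ℚSolver.+-*-Solver

27∣x∣⁶≡[3x²]³ : ∀ x → let X³ = ∣ x ∣ * ∣ x ∣ * ∣ x ∣ in
                fromℕ 27 * (X³ * X³) ≡ fromℕ 3 * (x * x) * (fromℕ 3 * (x * x)) * (fromℕ 3 * (x * x))
27∣x∣⁶≡[3x²]³ x = begin
  fromℕ 27 * (X * X * X * (X * X * X))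
    ≡⟨ solve 1 (λ X → con (fromℕ 27) :* (X :* X :* X :* (X :* X :* X)) :=
         con (fromℕ 3) :* (X :* X) :* (con (fromℕ 3) :* (X :* X)) :* (con (fromℕ 3) :* (X :* X))) refl X ⟩
  fromℕ 3 * (X * X) * (fromℕ 3 * (X * X)) * (fromℕ 3 * (X * X))
    ≡⟨ cong (λ s → fromℕ 3 * s * (fromℕ 3 * s) * (fromℕ 3 * s)) X²≡x² ⟩
  fromℕ 3 * (x * x) * (fromℕ 3 * (x * x)) * (fromℕ 3 * (x * x)) ∎
  where
  open ≡-Reasoning
  open ℚSolver.+-*-Solver
  X : ℚ
  X = ∣ x ∣
  X²≡x² : X * X ≡ x * x
  X²≡x² = trans (sym (∣p*q∣≡∣p∣*∣q∣ x x)) (0≤p⇒∣p∣≡p (0≤p*p x))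

∣x∣³≤N : ∀ x a N → fromℕ 3 * (x * x) < fromℕ 4 * fromℕ a →
         64 ℕ.* (a ℕ.* a ℕ.* a) ℕ.≤ 27 ℕ.* (N ℕ.* N) → ∣ x ∣ * ∣ x ∣ * ∣ x ∣ ≤ fromℕ N
∣x∣³≤N x a N 3x²<4a 64a³≤27N² =
  <⇒≤ (square-cancel-< (0≤fromℕ N) (*-cancelˡ-<-nonNeg (fromℕ 27) {{nonNegative (0≤fromℕ 27)}} 27X⁶<27N²))
  where
  X³ : ℚ
  X³ = ∣ x ∣ * ∣ x ∣ * ∣ x ∣
  27X⁶<27N² : fromℕ 27 * (X³ * X³) < fromℕ 27 * (fromℕ N * fromℕ N)
  27X⁶<27N² = begin-strict
    fromℕ 27 * (X³ * X³)                                           ≡⟨ 27∣x∣⁶≡[3x²]³ x ⟩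
    fromℕ 3 * (x * x) * (fromℕ 3 * (x * x)) * (fromℕ 3 * (x * x))  <⟨ cube-mono-< (0≤p*q (0≤fromℕ 3) (0≤p*p x)) 3x²<4a ⟩
    fromℕ 4 * fromℕ a * (fromℕ 4 * fromℕ a) * (fromℕ 4 * fromℕ a)  ≡⟨ 64n³≡[4n]³ a ⟨
    fromℕ (64 ℕ.* (a ℕ.* a ℕ.* a))                                 ≤⟨ fromℕ-mono-≤ 64a³≤27N² ⟩
    fromℕ (27 ℕ.* (N ℕ.* N))                                       ≡⟨ fromℕ-* 27 (N ℕ.* N) ⟩
    fromℕ 27 * fromℕ (N ℕ.* N)                                     ≡⟨ cong (fromℕ 27 *_) (fromℕ-* N N) ⟩
    fromℕ 27 * (fromℕ N * fromℕ N)                                 ∎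
    where open ≤-Reasoning

proposition2p2 : (A B : ℤ) → TwoComponents A B →
    (x y : ℚ) → OnCurve A B x y → OnBoundedComponent A B x →
    ∣ x ∣ * ∣ x ∣ * ∣ x ∣ ≤ (+ HE A B) / 1
proposition2p2 A B Δ>0 x y onCurve (t , x<t , f[t]<0) =
  subst (∣ x ∣ * ∣ x ∣ * ∣ x ∣ ≤_) (sym (/1≡fromℤ (+ HE A B))) (bound A Δ>0 3x²+4A<0)
  where
  3x²+4A<0 : fromℕ 3 * (x * x) + fromℕ 4 * fromℤ A < 0ℚ
  3x²+4A<0 = subst (λ a → fromℕ 3 * (x * x) + fromℕ 4 * a < 0ℚ) (/1≡fromℤ A)
                   (bounded-component⇒3x²+4a<0 (A / 1) (B / 1) (subst (0ℚ ≤_) onCurve (0≤p*p y)) x<t f[t]<0)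
  bound : ∀ A → TwoComponents A B → fromℕ 3 * (x * x) + fromℕ 4 * fromℤ A < 0ℚ →
          ∣ x ∣ * ∣ x ∣ * ∣ x ∣ ≤ fromℕ (HE A B)
  bound (+ n) _ 3x²+4n<0 = ⊥-elim (<-irrefl refl (≤-<-trans 0≤3x²+4n 3x²+4n<0))
    where
    0≤3x²+4n : 0ℚ ≤ fromℕ 3 * (x * x) + fromℕ 4 * fromℕ n
    0≤3x²+4n = 0≤p+q (0≤p*q (0≤fromℕ 3) (0≤p*p x)) (0≤p*q (0≤fromℕ 4) (0≤fromℕ n))
  bound -[1+ m ] Δ>0 3x²-4a<0 = ∣x∣³≤N x (suc m) (HE -[1+ m ] B) 3x²<4a (64∣A∣³≤27HE² m B Δ>0)
    where
    a : ℚ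
    a = fromℕ (suc m)
    -- fromℤ -[1+ m ] is definitionally - a.
    3x²<4a : fromℕ 3 * (x * x) < fromℕ 4 * a
    3x²<4a = subst (fromℕ 3 * (x * x) <_)
                   (solve 1 (λ a → :- (con (fromℕ 4) :* (:- a)) := con (fromℕ 4) :* a) refl a)
                   (p+q<0⇒p<-q 3x²-4a<0)
      where open ℚSolver.+-*-Solver
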